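{- Fix a positive integer $k$ and a partition $\lambda$ contained in the rectangle $\langle m^n\rangle$. Then there are at most $\min\{m,n\}$ partitions $\mu$ such that $\lambda\setminus\mu$ is a $k$-ribbon, and there are at most $\min\{m,n\}$ partitions $\mu\subset\langle m^n\rangle$ such that $\mu\setminus\lambda$ is a $k$-ribbon.
   Context: Partitions are identified with Ferrers diagrams $\{(i,j):1\le i\le\lambda_j\}$; $\subset$ is diagram containment; $\langle m^n\rangle$ is the partition with $n$ parts all equal to $m$ (an $m\times n$ rectangle). For $\mu\subset\lambda$, $\lambda\setminus\mu$ is the set of boxes of $\lambda$ not in $\mu$; it is a $k$-ribbon if it has $k$ boxes, is edgewise connected, and contains no $2\times 2$ block of boxes. -}

module Defs where

open import Data.Nat using (ℕ; zero; suc; _≤_; _<_; _≥_)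
open import Data.Product using (Σ; _×_; _,_)
open import Data.List using (List; []; _∷_; length; replicate)
open import Data.List.Relation.Unary.All using (All)
open import Data.List.Relation.Unary.Linked using (Linked)
open import Data.List.Relation.Unary.Unique.Propositional using (Unique)
open import Data.List.Membership.Propositional using (_∈_)
open import Relation.Binary.Construct.Closure.ReflexiveTransitive using (Star)
open import Relation.Nullary using (¬_)
open import Function.Bundles using (_⇔_)
open import Relation.Binary.PropositionalEquality using (_≡_)

IsPartition : List ℕ → Set
IsPartition xs = Linked _≥_ xs × All (0 <_) xs

-- j-th part (1-indexed); 0 for j = 0 or beyond the length.
part : List ℕ → ℕ → ℕ
part []       _             = 0
part (x ∷ xs) zero          = 0
part (x ∷ xs) (suc zero)    = x
part (x ∷ xs) (suc (suc j)) = part xs (suc j)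

Box : Set
Box = ℕ × ℕ

InDiagram : List ℕ → Box → Set
InDiagram la (i , j) = 1 ≤ j × 1 ≤ i × i ≤ part la j

_⊂_ : List ℕ → List ℕ → Set
mu ⊂ la = ∀ b → InDiagram mu b → InDiagram la b

rect : ℕ → ℕ → List ℕ
rect m n = replicate n m

InSkew : List ℕ → List ℕ → Box → Set
InSkew la mu b = InDiagram la b × ¬ InDiagram mu b

HasCard : (Box → Set) → ℕ → Set
HasCard S k = Σ (List Box) λ bs → Unique bs × (∀ b → (b ∈ bs) ⇔ S b) × length bs ≡ k

data Adj : Box → Box → Set where
  right : ∀ i j → Adj (i , j) (suc i , j)
  left  : ∀ i j → Adj (suc i , j) (i , j)
  down  : ∀ i j → Adj (i , j) (i , suc j)
  up    : ∀ i j → Adj (i , suc j) (i , j)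

Connected : (Box → Set) → Set
Connected S = ∀ a b → S a → S b → Star (λ x y → S x × S y × Adj x y) a b

No2x2 : (Box → Set) → Set
No2x2 S = ∀ i j → ¬ (S (i , j) × S (suc i , j) × S (i , suc j) × S (suc i , suc j))

IsRibbon : ℕ → (Box → Set) → Set
IsRibbon k S = HasCard S k × Connected S × No2x2 S

{-# OPTIONS --safe #-}
-- Index rows from the top, starting at 0. If O ∖ I is a ribbon of positive size occupying the
-- rows r … s, then I agrees with O outside these rows, I_t + 1 = O_(t+1) for r ≤ t < s (adjacent
-- rows of the ribbon share exactly one column, by the 2×2 condition) and O_(s+1) ≤ I_s (by
-- connectedness). Hence, for a fixed outer shape λ, the top row r as well as the length μ_s of the
-- bottom row decides which of two candidates μ, μ′ contains the other, and nested skew shapes of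
-- equal size coincide. Since r < n and μ_s < λ_s ≤ m, injectivity gives at most min(m, n)
-- candidates. Dually, for a fixed inner shape λ, the bottom row s < n and the length μ_r ≤ m of the
-- top row each determine μ.
module Submission where

open import Defs
open import Data.Nat
  using (ℕ; zero; suc; _≤_; _<_; _≥_; _+_; _⊓_; pred; z≤n; s≤s; z<s; s<s; _≤?_; _<?_; >-nonZero)
open import Data.Nat.Properties
open import Data.Product as Product using (_×_; _,_; proj₁; proj₂; ∃; ∃₂; ∃-syntax)
open import Data.Sum using (_⊎_; inj₁; inj₂; [_,_])
open import Data.List using (List; []; _∷_; length)
open import Data.List.Properties using (length-upTo; length-removeAt′)
open import Data.List.Relation.Unary.All as All using (All; []; _∷_)
open import Data.List.Relation.Unary.Any using (here; there; index)
open import Data.List.Relation.Unary.AllPairs using ([]; _∷_)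
open import Data.List.Relation.Unary.Linked as Linked using (Linked; []; [-]; _∷_)
open import Data.List.Relation.Unary.Unique.Propositional using (Unique)
open import Data.List.Relation.Binary.Subset.Propositional using () renaming (_⊆_ to _⊆ₗ_)
open import Data.List.Membership.Propositional using (_∈_; _─_)
open import Data.List.Membership.Propositional.Properties using (∈-upTo⁺)
open import Relation.Binary.Construct.Closure.ReflexiveTransitive using (Star; ε; _◅_)
open import Relation.Binary.Definitions using (tri<; tri≈; tri>)
open import Relation.Nullary using (¬_; Dec; yes; no)
open import Relation.Nullary.Negation using (contradiction)
open import Relation.Unary using (_⊆_)
open import Function using (_∘_)
open import Function.Bundles using (Equivalence)
open import Relation.Binary.PropositionalEquality
  using (_≡_; _≢_; _≗_; refl; sym; trans; cong₂; subst)

-- Counting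

∈-─⁺ : ∀ {A : Set} {x y : A} {ys} (x∈ys : x ∈ ys) → y ∈ ys → y ≢ x → y ∈ ys ─ x∈ys
∈-─⁺ (here refl)  (here refl)  y≢x = contradiction refl y≢x
∈-─⁺ (here refl)  (there y∈ys) _   = y∈ys
∈-─⁺ (there _)    (here refl)  _   = here refl
∈-─⁺ (there x∈ys) (there y∈ys) y≢x = there (∈-─⁺ x∈ys y∈ys y≢x)

module _ {A B : Set} (R : A → B → Set) (R-injective : ∀ {x y c} → R x c → R y c → x ≡ y) where

  length-≤-of-injection : ∀ {xs ys} → Unique xs → All (λ x → ∃[ c ] c ∈ ys × R x c) xs →
                          length xs ≤ length ys
  length-≤-of-injection []             []                                = z≤n
  length-≤-of-injection {x ∷ _} {ys} (x∉xs ∷ xs!) ((c , c∈ys , Rxc) ∷ images) =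
    subst (suc _ ≤_) (sym (length-removeAt′ ys (index c∈ys)))
      (s≤s (length-≤-of-injection xs! (All.zipWith restrict (x∉xs , images))))
    where
    restrict : ∀ {y} → x ≢ y × ∃[ d ] d ∈ ys × R y d → ∃[ d ] d ∈ ys ─ c∈ys × R y d
    restrict (x≢y , d , d∈ys , Ryd) =
      d , ∈-─⁺ c∈ys d∈ys (λ { refl → x≢y (R-injective Rxc Ryd) }) , Ryd

pigeonhole : ∀ {A : Set} (R : A → ℕ → Set) → (∀ {x y c} → R x c → R y c → x ≡ y) →
             ∀ N {xs} → Unique xs → All (λ x → ∃[ c ] c < N × R x c) xs → length xs ≤ N
pigeonhole R R-injective N xs! labels = subst (_ ≤_) (length-upTo N)
  (length-≤-of-injection R R-injective xs!
    (All.map (λ (c , c<N , Rxc) → c , ∈-upTo⁺ c<N , Rxc) labels))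

Unique-⊆⇒length-≤ : ∀ {A : Set} {xs ys : List A} → Unique xs → xs ⊆ₗ ys → length xs ≤ length ys
Unique-⊆⇒length-≤ xs! xs⊆ys =
  length-≤-of-injection _≡_ (λ { refl refl → refl }) xs!
    (All.tabulate (λ x∈xs → _ , xs⊆ys x∈xs , refl))

HasCard-nonempty : ∀ {S k} → HasCard S k → 0 < k → ∃ S
HasCard-nonempty ([]    , _ , _    , refl) ()
HasCard-nonempty (b ∷ _ , _ , bs↔S , _)    _ = b , Equivalence.to (bs↔S b) (here refl)

HasCard-⊆⇒⊇ : ∀ {S S' k} → HasCard S k → HasCard S' k → S ⊆ S' → ∀ b → S' b → ¬ ¬ S b
HasCard-⊆⇒⊇ (bs , bs! , bs↔S , refl) (bs' , _ , bs'↔S' , |bs'|≡|bs|) S⊆S' b S'b ¬Sb =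
  <-irrefl (sym |bs'|≡|bs|) (Unique-⊆⇒length-≤ (b∉bs ∷ bs!) b∷bs⊆bs')
  where
  b∉bs : All (b ≢_) bs
  b∉bs = All.tabulate (λ c∈bs b≡c → ¬Sb (Equivalence.to (bs↔S b) (subst (_∈ bs) (sym b≡c) c∈bs)))
  b∷bs⊆bs' : (b ∷ bs) ⊆ₗ bs'
  b∷bs⊆bs' (here refl) = Equivalence.from (bs'↔S' b) S'b
  b∷bs⊆bs' (there c∈bs) = Equivalence.from (bs'↔S' _) (S⊆S' (Equivalence.to (bs↔S _) c∈bs))

-- Partitions as row functions

-- Rows are indexed from 0, so the row t of a diagram consists of the boxes (i , suc t).
row : List ℕ → ℕ → ℕ
row xs t = part xs (suc t)

infix 4 _⊑_

_⊑_ : (ℕ → ℕ) → (ℕ → ℕ) → Set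
F ⊑ G = ∀ t → F t ≤ G t

NonIncreasing : (ℕ → ℕ) → Set
NonIncreasing F = ∀ t → F (suc t) ≤ F t

nonIncreasing⇒antitone : ∀ {F} → NonIncreasing F → ∀ {a b} → a ≤ b → F b ≤ F a
nonIncreasing⇒antitone F↓ {b = zero}  z≤n  = ≤-refl
nonIncreasing⇒antitone F↓ {b = suc b} a≤1+b with m≤n⇒m<n∨m≡n a≤1+b
... | inj₁ a<1+b = ≤-trans (F↓ b) (nonIncreasing⇒antitone F↓ (≤-pred a<1+b))
... | inj₂ refl  = ≤-refl

row-nonIncreasing : ∀ {xs} → Linked _≥_ xs → NonIncreasing (row xs)
row-nonIncreasing []        _       = z≤n
row-nonIncreasing [-]       zero    = z≤n
row-nonIncreasing [-]       (suc t) = z≤n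
row-nonIncreasing (x≥y ∷ _) zero    = x≥y
row-nonIncreasing (_ ∷ xs↓) (suc t) = row-nonIncreasing xs↓ t

partition-nonIncreasing : ∀ {xs} → IsPartition xs → NonIncreasing (row xs)
partition-nonIncreasing = row-nonIncreasing ∘ proj₁

row-beyond-length : ∀ xs {t} → length xs ≤ t → row xs t ≡ 0
row-beyond-length []       _            = refl
row-beyond-length (_ ∷ xs) (s≤s |xs|≤t) = row-beyond-length xs |xs|≤t

row-injective : ∀ {xs ys} → IsPartition xs → IsPartition ys → row xs ≗ row ys → xs ≡ ys
row-injective {[]}    {[]}    _             _             _  = refl
row-injective {[]}    {_ ∷ _} _             (_ , 0<y ∷ _) eq = contradiction (eq 0) (<⇒≢ 0<y)
row-injective {_ ∷ _} {[]}    (_ , 0<x ∷ _) _             eq = contradiction (sym (eq 0)) (<⇒≢ 0<x)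
row-injective {_ ∷ _} {_ ∷ _} (xs↓ , 0<x ∷ xs+) (ys↓ , 0<y ∷ ys+) eq =
  cong₂ _∷_ (eq 0) (row-injective (Linked.tail xs↓ , xs+) (Linked.tail ys↓ , ys+) (eq ∘ suc))

⊂⇒⊑ : ∀ {mu la} → mu ⊂ la → row mu ⊑ row la
⊂⇒⊑ {mu} mu⊂la t with row mu t in eq
... | zero  = z≤n
... | suc i = proj₂ (proj₂ (mu⊂la (suc i , suc t) (s≤s z≤n , s≤s z≤n , ≤-reflexive (sym eq))))

row-rect : ∀ m n {t} → 0 < row (rect m n) t → t < n × row (rect m n) t ≡ m
row-rect m (suc n) {zero}  _   = z<s , refl
row-rect m (suc n) {suc t} pos = Product.map₁ s<s (row-rect m n pos)

⊂-rect : ∀ {la m n t} → la ⊂ rect m n → 0 < row la t → t < n × row la t ≤ m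
⊂-rect {la} {m} {n} {t} la⊂rect pos =
  let la≤rect       = ⊂⇒⊑ {la} {rect m n} la⊂rect t
      t<n , rect≡m = row-rect m n (<-≤-trans pos la≤rect)
  in  t<n , subst (row la t ≤_) rect≡m la≤rect

inSkew⁺ : ∀ {O I i t} → 0 < i → row I t < i → i ≤ row O t → InSkew O I (i , suc t)
inSkew⁺ 0<i I<i i≤O = (s≤s z≤n , 0<i , i≤O) , λ (_ , _ , i≤I) → <⇒≱ I<i i≤I

inSkew⁻ : ∀ {O I i t} → InSkew O I (i , suc t) → 0 < i × row I t < i × i ≤ row O t
inSkew⁻ ((_ , 0<i , i≤O) , ∉I) = 0<i , ≰⇒> (λ i≤I → ∉I (s≤s z≤n , 0<i , i≤I)) , i≤O

InSkew-mono : ∀ {O I O' I'} → row I' ⊑ row I → row O ⊑ row O' → InSkew O I ⊆ InSkew O' I'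
InSkew-mono I'⊑I O⊑O' {_ , zero}  ((() , _) , _)
InSkew-mono {O} {I} {O'} {I'} I'⊑I O⊑O' {i , suc t} cell with inSkew⁻ {O} {I} cell
... | 0<i , I<i , i≤O = inSkew⁺ {O'} {I'} 0<i (≤-<-trans (I'⊑I t) I<i) (≤-trans i≤O (O⊑O' t))

-- Skew shapes of equal size can only be nested if they coincide.
⊑-of-nested-inner : ∀ {O I I' k} → HasCard (InSkew O I) k → HasCard (InSkew O I') k →
                    row I ⊑ row O → row I' ⊑ row I → row I ⊑ row I'
⊑-of-nested-inner {O} {I} {I'} card card' I⊑O I'⊑I t = ≮⇒≥ λ I'<I →
  HasCard-⊆⇒⊇ card card' (InSkew-mono {O} {I} {O} {I'} I'⊑I (λ _ → ≤-refl)) _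
    (inSkew⁺ {O} {I'} (≤-<-trans z≤n I'<I) I'<I (I⊑O t))
    (λ cell → <-irrefl refl (proj₁ (proj₂ (inSkew⁻ {O} {I} cell))))

⊑-of-nested-outer : ∀ {O O' I k} → HasCard (InSkew O I) k → HasCard (InSkew O' I) k →
                    row I ⊑ row O → row O ⊑ row O' → row O' ⊑ row O
⊑-of-nested-outer {O} {O'} {I} card card' I⊑O O⊑O' t = ≮⇒≥ λ O<O' →
  HasCard-⊆⇒⊇ card card' (InSkew-mono {O} {I} {O'} {I} (λ _ → ≤-refl) O⊑O') _
    (inSkew⁺ {O'} {I} (≤-<-trans z≤n O<O') (≤-<-trans (I⊑O t) O<O') ≤-refl)
    (λ cell → <⇒≱ O<O' (proj₂ (proj₂ (inSkew⁻ {O} {I} cell))))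

-- The shape of a ribbon

record Least (Q : ℕ → Set) (a : ℕ) : Set where
  field
    value   : ℕ
    a≤value : a ≤ value
    holds   : Q value
    minimal : ∀ t → a ≤ t → t < value → ¬ Q t

least-≥ : ∀ {Q : ℕ → Set} → (∀ t → Dec (Q t)) → ∀ a d → Q (a + d) → Least Q a
least-≥ {Q} Q? a = scan a ≤-refl (λ t a≤t t<a → contradiction a≤t (<⇒≱ t<a))
  where
  scan : ∀ c → a ≤ c → (∀ t → a ≤ t → t < c → ¬ Q t) → ∀ d → Q (c + d) → Least Q a
  scan c a≤c none-below d _ with Q? c
  ... | yes Qc = record { value = c ; a≤value = a≤c ; holds = Qc ; minimal = none-below }
  scan c _   _          zero    Q[c+0]   | no ¬Qc =
    contradiction (subst Q (+-identityʳ c) Q[c+0]) ¬Qc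
  scan c a≤c none-below (suc d) Q[c+1+d] | no ¬Qc =
    scan (suc c) (m≤n⇒m≤1+n a≤c) none-up-to-c d (subst Q (+-suc c d) Q[c+1+d])
    where
    none-up-to-c : ∀ t → a ≤ t → t < suc c → ¬ Q t
    none-up-to-c t a≤t t<1+c with m<1+n⇒m<n∨m≡n t<1+c
    ... | inj₁ t<c  = none-below t a≤t t<c
    ... | inj₂ refl = ¬Qc

-- The skew shape between outer rows F and inner rows G is a ribbon occupying exactly the
-- rows r … s, where consecutive rows share exactly one column.
record Ribbon (F G : ℕ → ℕ) (r s : ℕ) : Set where
  field
    r≤s      : r ≤ s
    above    : ∀ t → t < r → G t ≡ F t
    top      : G r < F r
    linked   : ∀ t → r ≤ t → t < s → suc (G t) ≡ F (suc t)
    detached : F (suc s) ≤ G s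
    below    : ∀ t → s < t → G t ≡ F t

open Ribbon

Ribbon-bottom : ∀ {F G r s} → NonIncreasing G → Ribbon F G r s → G s < F s
Ribbon-bottom {F} {G} G↓ p with m≤n⇒m<n∨m≡n (r≤s p)
... | inj₂ refl = top p
... | inj₁ (s≤s {n = u} r≤u) = begin-strict
  G (suc u)  ≤⟨ G↓ u ⟩
  G u        <⟨ n<1+n (G u) ⟩
  suc (G u)  ≡⟨ linked p u r≤u ≤-refl ⟩
  F (suc u)  ∎
  where open ≤-Reasoning

overlap-≤1 : ∀ {O I} → NonIncreasing (row O) → NonIncreasing (row I) → No2x2 (InSkew O I) →
             ∀ t → row O (suc t) ≤ suc (row I t)
overlap-≤1 {O} {I} O↓ I↓ no2x2 t = ≮⇒≥ λ 2+I≤O → no2x2 (suc (row I t)) (suc t)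
  ( inSkew⁺ {O} {I} z<s ≤-refl (≤-trans (<⇒≤ 2+I≤O) (O↓ t))
  , inSkew⁺ {O} {I} z<s (n≤1+n _) (≤-trans 2+I≤O (O↓ t))
  , inSkew⁺ {O} {I} z<s (s≤s (I↓ t)) (<⇒≤ 2+I≤O)
  , inSkew⁺ {O} {I} z<s (s≤s (≤-trans (I↓ t) (n≤1+n _))) 2+I≤O )

SkewStep : List ℕ → List ℕ → Box → Box → Set
SkewStep O I a b = InSkew O I a × InSkew O I b × Adj a b

-- A row t with row O (suc t) ≤ row I t is a wall: no path inside the skew shape crosses it.
step-confined : ∀ {O I a b t} → row O (suc t) ≤ row I t → SkewStep O I a b →
                proj₂ a ≤ suc t → proj₂ b ≤ suc t
step-confined _ (_ , _ , right _ _) a≤ = a≤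
step-confined _ (_ , _ , left _ _)  a≤ = a≤
step-confined _ (_ , _ , up _ j)    a≤ = ≤-trans (n≤1+n j) a≤
step-confined {O} {I} wall (a-cell , b-cell , down _ _) j≤1+t with m≤n⇒m<n∨m≡n j≤1+t
... | inj₁ j<1+t = j<1+t
... | inj₂ refl  = contradiction (≤-trans (proj₂ (proj₂ (inSkew⁻ {O} {I} b-cell))) wall)
                                 (<⇒≱ (proj₁ (proj₂ (inSkew⁻ {O} {I} a-cell))))

confined : ∀ {O I a b t} → row O (suc t) ≤ row I t → Star (SkewStep O I) a b →
           proj₂ a ≤ suc t → proj₂ b ≤ suc t
confined         wall ε             = λ a≤ → a≤
confined {O} {I} wall (step ◅ path) = confined {O} {I} wall path ∘ step-confined {O} {I} wall step

ribbon-profile : ∀ {O I k} → IsPartition O → IsPartition I → I ⊂ O → 0 < k →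
                 IsRibbon k (InSkew O I) → ∃₂ (Ribbon (row O) (row I))
ribbon-profile {O} {I} O-part I-part I⊂O 0<k (card , connected , no2x2) =
  r , s , record { r≤s = r≤s′ ; above = above′ ; top = top′ ; linked = linked′
                 ; detached = detached′ ; below = below′ }
  where
  I⊑O : row I ⊑ row O
  I⊑O = ⊂⇒⊑ {I} {O} I⊂O

  cell : ∀ t → row I t < row O t → InSkew O I (row O t , suc t)
  cell t I<O = inSkew⁺ {O} {I} (≤-<-trans z≤n I<O) I<O ≤-refl

  first-nonempty-row : Least (λ t → row I t < row O t) 0
  first-nonempty-row with HasCard-nonempty card 0<k
  ... | (_ , zero)  , ((() , _) , _)
  ... | (_ , suc t) , c with inSkew⁻ {O} {I} c
  ...   | _ , I<i , i≤O = least-≥ (λ t → row I t <? row O t) 0 t (<-≤-trans I<i i≤O)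
  open Least first-nonempty-row using ()
    renaming (value to r; holds to top′; minimal to r-minimal)

  far-row-detached : row O (suc (r + length O)) ≤ row I (r + length O)
  far-row-detached = subst (_≤ row I (r + length O))
    (sym (row-beyond-length O (m≤n⇒m≤1+n (m≤n+m (length O) r)))) z≤n

  first-detached-row : Least (λ t → row O (suc t) ≤ row I t) r
  first-detached-row = least-≥ (λ t → row O (suc t) ≤? row I t) r (length O) far-row-detached
  open Least first-detached-row using ()
    renaming (value to s; a≤value to r≤s′; holds to detached′; minimal to s-minimal)

  above′ : ∀ t → t < r → row I t ≡ row O t
  above′ t t<r = ≤-antisym (I⊑O t) (≮⇒≥ (r-minimal t z≤n t<r))

  linked′ : ∀ t → r ≤ t → t < s → suc (row I t) ≡ row O (suc t)
  linked′ t r≤t t<s = ≤-antisym (≰⇒> (s-minimal t r≤t t<s))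
    (overlap-≤1 {O} {I} (partition-nonIncreasing O-part) (partition-nonIncreasing I-part) no2x2 t)

  below′ : ∀ t → s < t → row I t ≡ row O t
  below′ t s<t = ≤-antisym (I⊑O t) (≮⇒≥ λ I<O →
    <⇒≱ s<t (≤-pred (confined {O} {I} detached′
                       (connected _ _ (cell r top′) (cell t I<O)) (s≤s r≤s′))))

-- Ribbons with a common outer or inner boundary

data SplitLast (r s : ℕ) : ℕ → Set where
  before : ∀ {t} → t < r → SplitLast r s t
  inside : ∀ {t} → r ≤ t → t < s → SplitLast r s t
  last   : SplitLast r s s
  after  : ∀ {t} → s < t → SplitLast r s t

splitLast : ∀ r s t → SplitLast r s t
splitLast r s t with t <? r | s <? t
... | yes t<r | _       = before t<r
... | no _    | yes s<t = after s<t
... | no t≮r  | no s≮t  with m≤n⇒m<n∨m≡n (≮⇒≥ s≮t)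
...   | inj₁ t<s  = inside (≮⇒≥ t≮r) t<s
...   | inj₂ refl = last

data SplitFirst (r s : ℕ) : ℕ → Set where
  before : ∀ {t} → t < r → SplitFirst r s t
  first  : SplitFirst r s r
  inside : ∀ {u} → r ≤ u → u < s → SplitFirst r s (suc u)
  after  : ∀ {t} → s < t → SplitFirst r s t

splitFirst : ∀ r s t → SplitFirst r s t
splitFirst r s t with t <? r | s <? t
... | yes t<r | _       = before t<r
... | no _    | yes s<t = after s<t
... | no t≮r  | no s≮t  with m≤n⇒m<n∨m≡n (≮⇒≥ t≮r)
...   | inj₁ (s≤s r≤u) = inside r≤u (≮⇒≥ s≮t)
...   | inj₂ refl      = first

Comparable : (ℕ → ℕ) → (ℕ → ℕ) → Set
Comparable F G = F ⊑ G ⊎ G ⊑ F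

inner-⊑ : ∀ {F G G' r s r' s'} → G ⊑ F → Ribbon F G r s → Ribbon F G' r' s' →
          r ≤ r' → s' ≤ s → (s ≡ s' → G s ≤ G' s) → G ⊑ G'
inner-⊑ {G = G} {r' = r'} {s'} G⊑F p p' r≤r' s'≤s last-≤ t with splitLast r' s' t
... | before t<r'      = subst (G t ≤_) (sym (above p' t t<r')) (G⊑F t)
... | after s'<t       = subst (G t ≤_) (sym (below p' t s'<t)) (G⊑F t)
... | inside r'≤t t<s' = ≤-reflexive (suc-injective
  (trans (linked p t (≤-trans r≤r' r'≤t) (<-≤-trans t<s' s'≤s)) (sym (linked p' t r'≤t t<s'))))
... | last with m≤n⇒m<n∨m≡n s'≤s
...   | inj₁ s'<s =
  <⇒≤ (≤-trans (≤-reflexive (linked p _ (≤-trans r≤r' (r≤s p')) s'<s)) (detached p'))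
...   | inj₂ refl = last-≤ refl

bottom-< : ∀ {F G G' r s r' s'} → NonIncreasing F → NonIncreasing G' →
           Ribbon F G r s → Ribbon F G' r' s' → s < s' → G' s' < G s
bottom-< {F} {G} {G'} {s = s} {s' = s'} F↓ G'↓ p p' s<s' = begin-strict
  G' s'     <⟨ Ribbon-bottom G'↓ p' ⟩
  F s'      ≤⟨ nonIncreasing⇒antitone F↓ s<s' ⟩
  F (suc s) ≤⟨ detached p ⟩
  G s       ∎
  where open ≤-Reasoning

outer-⊑ : ∀ {F F' G r s r' s'} → NonIncreasing F' → G ⊑ F → Ribbon F G r s → Ribbon F' G r' s' →
          r ≤ r' → s' ≤ s → (r ≡ r' → F' r ≤ F r) → F' ⊑ F
outer-⊑ {F} {F'} {G} {r' = r'} {s'} F'↓ G⊑F p p' r≤r' s'≤s first-≤ t with splitFirst r' s' t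
... | before t<r'          = subst (_≤ F t) (above p' t t<r') (G⊑F t)
... | after s'<t           = subst (_≤ F t) (below p' t s'<t) (G⊑F t)
... | inside {u} r'≤u u<s' = ≤-reflexive
  (trans (sym (linked p' u r'≤u u<s')) (linked p u (≤-trans r≤r' r'≤u) (<-≤-trans u<s' s'≤s)))
... | first with m≤n⇒m<n∨m≡n r≤r'
...   | inj₂ refl = first-≤ refl
...   | inj₁ (s≤s {n = u} r≤u) = begin
  F' (suc u) ≤⟨ F'↓ u ⟩
  F' u       ≡⟨ above p' u ≤-refl ⟨
  G u        ≤⟨ n≤1+n (G u) ⟩
  suc (G u)  ≡⟨ linked p u r≤u (≤-trans (r≤s p') s'≤s) ⟩
  F (suc u)  ∎
  where open ≤-Reasoning

top-< : ∀ {F F' G r s r' s'} → NonIncreasing G → NonIncreasing F' →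
        Ribbon F G r s → Ribbon F' G r' s' → r < r' → F' r' < F r
top-< {F} {F'} {G} {r} G↓ F'↓ p p' (s≤s {n = u} r≤u) = begin-strict
  F' (suc u) ≤⟨ F'↓ u ⟩
  F' u       ≡⟨ above p' u ≤-refl ⟨
  G u        ≤⟨ nonIncreasing⇒antitone G↓ r≤u ⟩
  G r        <⟨ top p ⟩
  F r        ∎
  where open ≤-Reasoning

comparable-of-same-top : ∀ {F G G' r s s'} → G ⊑ F → G' ⊑ F →
                         Ribbon F G r s → Ribbon F G' r s' → Comparable G G'
comparable-of-same-top {G = G} {G'} {s = s} {s'} G⊑F G'⊑F p p' with <-cmp s s'
... | tri< s<s' s≢s' _ =
  inj₂ (inner-⊑ G'⊑F p' p ≤-refl (<⇒≤ s<s') (λ s'≡s → contradiction (sym s'≡s) s≢s'))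
... | tri> _ s≢s' s'<s =
  inj₁ (inner-⊑ G⊑F p p' ≤-refl (<⇒≤ s'<s) (λ s≡s' → contradiction s≡s' s≢s'))
... | tri≈ _ refl _ with ≤-total (G s) (G' s)
...   | inj₁ Gs≤G's = inj₁ (inner-⊑ G⊑F p p' ≤-refl ≤-refl (λ _ → Gs≤G's))
...   | inj₂ G's≤Gs = inj₂ (inner-⊑ G'⊑F p' p ≤-refl ≤-refl (λ _ → G's≤Gs))

comparable-of-same-bottom-length : ∀ {F G G' r s r' s'} →
  NonIncreasing F → NonIncreasing G → NonIncreasing G' → G ⊑ F → G' ⊑ F →
  Ribbon F G r s → Ribbon F G' r' s' → G s ≡ G' s' → Comparable G G'
comparable-of-same-bottom-length {r = r} {s} {r'} {s'} F↓ G↓ G'↓ G⊑F G'⊑F p p' eq with <-cmp s s'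
... | tri< s<s' _ _ = contradiction (sym eq) (<⇒≢ (bottom-< F↓ G'↓ p p' s<s'))
... | tri> _ _ s'<s = contradiction eq (<⇒≢ (bottom-< F↓ G↓ p' p s'<s))
... | tri≈ _ refl _ with ≤-total r r'
...   | inj₁ r≤r' = inj₁ (inner-⊑ G⊑F p p' r≤r' ≤-refl (λ _ → ≤-reflexive eq))
...   | inj₂ r'≤r = inj₂ (inner-⊑ G'⊑F p' p r'≤r ≤-refl (λ _ → ≤-reflexive (sym eq)))

comparable-of-same-bottom : ∀ {F F' G r s r'} →
  NonIncreasing F → NonIncreasing F' → G ⊑ F → G ⊑ F' →
  Ribbon F G r s → Ribbon F' G r' s → Comparable F F'
comparable-of-same-bottom {F} {F'} {r = r} {r' = r'} F↓ F'↓ G⊑F G⊑F' p p' with <-cmp r r'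
... | tri< r<r' r≢r' _ =
  inj₂ (outer-⊑ F'↓ G⊑F p p' (<⇒≤ r<r') ≤-refl (λ r≡r' → contradiction r≡r' r≢r'))
... | tri> _ r≢r' r'<r =
  inj₁ (outer-⊑ F↓ G⊑F' p' p (<⇒≤ r'<r) ≤-refl (λ r'≡r → contradiction (sym r'≡r) r≢r'))
... | tri≈ _ refl _ with ≤-total (F r) (F' r)
...   | inj₁ Fr≤F'r = inj₁ (outer-⊑ F↓ G⊑F' p' p ≤-refl ≤-refl (λ _ → Fr≤F'r))
...   | inj₂ F'r≤Fr = inj₂ (outer-⊑ F'↓ G⊑F p p' ≤-refl ≤-refl (λ _ → F'r≤Fr))

comparable-of-same-top-length : ∀ {F F' G r s r' s'} →
  NonIncreasing G → NonIncreasing F → NonIncreasing F' → G ⊑ F → G ⊑ F' →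
  Ribbon F G r s → Ribbon F' G r' s' → F r ≡ F' r' → Comparable F F'
comparable-of-same-top-length {r = r} {s} {r'} {s'} G↓ F↓ F'↓ G⊑F G⊑F' p p' eq with <-cmp r r'
... | tri< r<r' _ _ = contradiction (sym eq) (<⇒≢ (top-< G↓ F'↓ p p' r<r'))
... | tri> _ _ r'<r = contradiction eq (<⇒≢ (top-< G↓ F↓ p' p r'<r))
... | tri≈ _ refl _ with ≤-total s s'
...   | inj₁ s≤s' = inj₁ (outer-⊑ F↓ G⊑F' p' p ≤-refl s≤s' (λ _ → ≤-reflexive eq))
...   | inj₂ s'≤s = inj₂ (outer-⊑ F'↓ G⊑F p p' ≤-refl s'≤s (λ _ → ≤-reflexive (sym eq)))

module RemovableRibbons {k m n : ℕ} {la : List ℕ}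
                        (0<k : 0 < k) (la-part : IsPartition la) (la⊂rect : la ⊂ rect m n) where

  Removable : List ℕ → Set
  Removable mu = IsPartition mu × mu ⊂ la × IsRibbon k (InSkew la mu)

  profile : ∀ {mu} → Removable mu → ∃₂ (Ribbon (row la) (row mu))
  profile (mu-part , mu⊂la , ribbon) = ribbon-profile la-part mu-part mu⊂la 0<k ribbon

  removable-⊑ : ∀ {mu} → Removable mu → row mu ⊑ row la
  removable-⊑ {mu} (_ , mu⊂la , _) = ⊂⇒⊑ {mu} {la} mu⊂la

  ≡-of-⊑ : ∀ {mu mu'} → Removable mu → Removable mu' → row mu ⊑ row mu' → mu ≡ mu'
  ≡-of-⊑ {mu} {mu'} v@(mu-part , _ , card , _) v'@(mu'-part , _ , card' , _) mu⊑mu' =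
    row-injective mu-part mu'-part λ t → ≤-antisym (mu⊑mu' t)
      (⊑-of-nested-inner {la} {mu'} {mu} card' card (removable-⊑ v') mu⊑mu' t)

  ≡-of-comparable : ∀ {mu mu'} → Removable mu → Removable mu' →
                    Comparable (row mu) (row mu') → mu ≡ mu'
  ≡-of-comparable v v' = [ ≡-of-⊑ v v' , sym ∘ ≡-of-⊑ v' v ]

  HasTopRow : List ℕ → ℕ → Set
  HasTopRow mu r = Removable mu × ∃[ s ] Ribbon (row la) (row mu) r s

  top-row-injective : ∀ {mu mu' r} → HasTopRow mu r → HasTopRow mu' r → mu ≡ mu'
  top-row-injective (v , _ , p) (v' , _ , p') =
    ≡-of-comparable v v' (comparable-of-same-top (removable-⊑ v) (removable-⊑ v') p p')

  HasBottomLength : List ℕ → ℕ → Set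
  HasBottomLength mu c = Removable mu × ∃₂ λ r s → Ribbon (row la) (row mu) r s × row mu s ≡ c

  bottom-length-injective : ∀ {mu mu' c} → HasBottomLength mu c → HasBottomLength mu' c → mu ≡ mu'
  bottom-length-injective (v , _ , _ , p , eq) (v' , _ , _ , p' , eq') =
    ≡-of-comparable v v' (comparable-of-same-bottom-length
      (partition-nonIncreasing la-part)
      (partition-nonIncreasing (proj₁ v)) (partition-nonIncreasing (proj₁ v'))
      (removable-⊑ v) (removable-⊑ v') p p' (trans eq (sym eq')))

  count-≤-n : ∀ {mus} → Unique mus → All Removable mus → length mus ≤ n
  count-≤-n mus! removable =
    pigeonhole HasTopRow top-row-injective n mus! (All.map label removable)
    where
    label : ∀ {mu} → Removable mu → ∃[ r ] r < n × HasTopRow mu r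
    label v with profile v
    ... | r , s , p = r , proj₁ (⊂-rect {la} {m} {n} la⊂rect (≤-<-trans z≤n (top p))) , v , s , p

  count-≤-m : ∀ {mus} → Unique mus → All Removable mus → length mus ≤ m
  count-≤-m mus! removable =
    pigeonhole HasBottomLength bottom-length-injective m mus! (All.map label removable)
    where
    label : ∀ {mu} → Removable mu → ∃[ c ] c < m × HasBottomLength mu c
    label {mu} v with profile v
    ... | r , s , p = row mu s , <-≤-trans mu<la la≤m , v , r , s , p , refl
      where
      mu<la : row mu s < row la s
      mu<la = Ribbon-bottom (partition-nonIncreasing (proj₁ v)) p
      la≤m : row la s ≤ m
      la≤m = proj₂ (⊂-rect {la} {m} {n} la⊂rect (≤-<-trans z≤n mu<la))

module AddableRibbons {k m n : ℕ} {la : List ℕ} (0<k : 0 < k) (la-part : IsPartition la) where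

  Addable : List ℕ → Set
  Addable mu = IsPartition mu × mu ⊂ rect m n × la ⊂ mu × IsRibbon k (InSkew mu la)

  profile : ∀ {mu} → Addable mu → ∃₂ (Ribbon (row mu) (row la))
  profile (mu-part , _ , la⊂mu , ribbon) = ribbon-profile mu-part la-part la⊂mu 0<k ribbon

  addable-⊒ : ∀ {mu} → Addable mu → row la ⊑ row mu
  addable-⊒ {mu} (_ , _ , la⊂mu , _) = ⊂⇒⊑ {la} {mu} la⊂mu

  ≡-of-⊑ : ∀ {mu mu'} → Addable mu → Addable mu' → row mu ⊑ row mu' → mu ≡ mu'
  ≡-of-⊑ {mu} {mu'} v@(mu-part , _ , _ , card , _) (mu'-part , _ , _ , card' , _) mu⊑mu' =
    row-injective mu-part mu'-part λ t → ≤-antisym (mu⊑mu' t)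
      (⊑-of-nested-outer {mu} {mu'} {la} card card' (addable-⊒ v) mu⊑mu' t)

  ≡-of-comparable : ∀ {mu mu'} → Addable mu → Addable mu' →
                    Comparable (row mu) (row mu') → mu ≡ mu'
  ≡-of-comparable v v' = [ ≡-of-⊑ v v' , sym ∘ ≡-of-⊑ v' v ]

  HasBottomRow : List ℕ → ℕ → Set
  HasBottomRow mu s = Addable mu × ∃[ r ] Ribbon (row mu) (row la) r s

  bottom-row-injective : ∀ {mu mu' s} → HasBottomRow mu s → HasBottomRow mu' s → mu ≡ mu'
  bottom-row-injective (v , _ , p) (v' , _ , p') =
    ≡-of-comparable v v' (comparable-of-same-bottom
      (partition-nonIncreasing (proj₁ v)) (partition-nonIncreasing (proj₁ v'))
      (addable-⊒ v) (addable-⊒ v') p p')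

  -- The key is the length of the top row minus one, so that it ranges over 0 … m - 1.
  HasTopLength : List ℕ → ℕ → Set
  HasTopLength mu c = Addable mu × ∃₂ λ r s → Ribbon (row mu) (row la) r s × row mu r ≡ suc c

  top-length-injective : ∀ {mu mu' c} → HasTopLength mu c → HasTopLength mu' c → mu ≡ mu'
  top-length-injective (v , _ , _ , p , eq) (v' , _ , _ , p' , eq') =
    ≡-of-comparable v v' (comparable-of-same-top-length
      (partition-nonIncreasing la-part)
      (partition-nonIncreasing (proj₁ v)) (partition-nonIncreasing (proj₁ v'))
      (addable-⊒ v) (addable-⊒ v') p p' (trans eq (sym eq')))

  count-≤-n : ∀ {mus} → Unique mus → All Addable mus → length mus ≤ n
  count-≤-n mus! addable =
    pigeonhole HasBottomRow bottom-row-injective n mus! (All.map label addable)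
    where
    label : ∀ {mu} → Addable mu → ∃[ s ] s < n × HasBottomRow mu s
    label {mu} v@(_ , mu⊂rect , _) with profile v
    ... | r , s , p = s , proj₁ (⊂-rect {mu} {m} {n} mu⊂rect 0<mu) , v , r , p
      where
      0<mu : 0 < row mu s
      0<mu = ≤-<-trans z≤n (Ribbon-bottom (partition-nonIncreasing la-part) p)

  count-≤-m : ∀ {mus} → Unique mus → All Addable mus → length mus ≤ m
  count-≤-m mus! addable =
    pigeonhole HasTopLength top-length-injective m mus! (All.map label addable)
    where
    label : ∀ {mu} → Addable mu → ∃[ c ] c < m × HasTopLength mu c
    label {mu} v@(_ , mu⊂rect , _) with profile v
    ... | r , s , p = pred (row mu r) , subst (_≤ m) eq (proj₂ (⊂-rect {mu} {m} {n} mu⊂rect 0<mu))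
                    , v , r , s , p , eq
      where
      0<mu : 0 < row mu r
      0<mu = ≤-<-trans z≤n (top p)
      eq : row mu r ≡ suc (pred (row mu r))
      eq = sym (suc-pred (row mu r) {{>-nonZero 0<mu}})

mainTheorem9 : (k m n : ℕ) → 1 ≤ k → (la : List ℕ) → IsPartition la → la ⊂ rect m n →
    ((mus : List (List ℕ)) → Unique mus →
      All (λ mu → IsPartition mu × mu ⊂ la × IsRibbon k (InSkew la mu)) mus →
      length mus ≤ m ⊓ n)
    × ((mus : List (List ℕ)) → Unique mus →
      All (λ mu → IsPartition mu × mu ⊂ rect m n × la ⊂ mu × IsRibbon k (InSkew mu la)) mus →
      length mus ≤ m ⊓ n)
mainTheorem9 k m n 0<k la la-part la⊂rect =
  (λ _ mus! removable → ⊓-glb (Removable.count-≤-m mus! removable)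
                               (Removable.count-≤-n mus! removable)) ,
  (λ _ mus! addable → ⊓-glb (Addable.count-≤-m mus! addable) (Addable.count-≤-n mus! addable))
  where
  module Removable = RemovableRibbons {m = m} {n} 0<k la-part la⊂rect
  module Addable = AddableRibbons {m = m} {n} 0<k la-part
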